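{- Let $d=(d_1,\ldots,d_n)$ be a non-increasing sequence of positive integers. If $d$ has a realization $G=(V,E)$ with $V=\{v_1,\ldots,v_n\}$, $\deg_G(v_i)=d_i$ for every $i\in[1,n]$, having a matching $M$ of size $\nu$, then $d$ has a realization $G'=(V,E')$ with $\deg_{G'}(v_i)=d_i$ for every $i\in[1,n]$ such that $M'=\{(v_i,v_{2\nu-i+1}) : i\in[1,\nu]\}$ is a matching contained in $E'$.
   Context: Graphs are simple and undirected. A realization of $d$ is a graph whose vertex degrees are given by $d$. $[a,b]=\{a,\ldots,b\}$. -}

module Defs where

open import Data.Nat using (ℕ; _≤_; _≥_)
open import Data.Bool using (Bool; true; false; if_then_else_)
open import Data.Fin using (Fin; toℕ)
open import Data.Sum using (_⊎_; inj₁; inj₂)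
open import Data.List using (map; allFin)
open import Data.Nat.ListAction using (sum)
open import Function.Definitions using (Injective)
open import Relation.Binary.PropositionalEquality using (_≡_)

-- A simple undirected graph on the vertex set Fin n (vertex v_{i+1} is Fin index i).
record Graph (n : ℕ) : Set where
  field
    adj     : Fin n → Fin n → Bool
    sym     : ∀ i j → adj i j ≡ adj j i
    irrefl  : ∀ i → adj i i ≡ false
open Graph public

deg : ∀ {n} → Graph n → Fin n → ℕ
deg {n} G i = sum (map (λ j → if adj G i j then 1 else 0) (allFin n))

Realizes : ∀ {n} → Graph n → (Fin n → ℕ) → Set
Realizes G d = ∀ i → deg G i ≡ d i

NonIncreasing : ∀ {n} → (Fin n → ℕ) → Set
NonIncreasing {n} d = ∀ (i j : Fin n) → toℕ i ≤ toℕ j → d i ≥ d j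

Positive : ∀ {n} → (Fin n → ℕ) → Set
Positive d = ∀ i → d i ≥ 1

-- A matching of size ν in G: ν edges (end₁ k, end₂ k), pairwise vertex-disjoint
-- (all 2ν endpoints distinct).
pairEnd : ∀ {n ν : ℕ} → (Fin ν → Fin n) → (Fin ν → Fin n) → Fin ν ⊎ Fin ν → Fin n
pairEnd e₁ e₂ (inj₁ k) = e₁ k
pairEnd e₁ e₂ (inj₂ k) = e₂ k

record Matching {n : ℕ} (G : Graph n) (ν : ℕ) : Set where
  field
    end₁ : Fin ν → Fin n
    end₂ : Fin ν → Fin n
    isEdge : ∀ k → adj G (end₁ k) (end₂ k) ≡ true
    disjoint : Injective _≡_ _≡_ (pairEnd end₁ end₂)

{-# OPTIONS --safe #-}
module Submission where

-- Encode the matching as 2ν slots, slot p being matched with slot (partner p), and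
-- change the realization only by 2-switches, which preserve all degrees. If deg y ≤ deg x and yz
-- is an edge, a 2-switch moves it to xz without touching the edges away from x and y; two such moves
-- turn matching edges ka, tb into kt, ab whenever deg b ≤ deg k and deg t ≤ deg a. As d is
-- non-increasing, a smaller index means a larger degree. First every matched vertex outside
-- v₁ … v₂ν is replaced by an unmatched vertex inside (pigeonhole), so that the matching covers
-- exactly v₁ … v₂ν. Then for k = 1 … ν in turn, v_k is rematched with its mirror image v_{2ν-k+1}:
-- the current partners of both lie between them, which is exactly the degree condition above.

open import Algebra.Definitions using (Involutive)
open import Data.Bool using (Bool; true; false; not; _∧_; _∨_; _xor_; if_then_else_)
open import Data.Bool.Properties as Bool
  using (∧-comm; ∧-zeroʳ; ∨-comm; ∨-identityʳ; ∨-zeroʳ; not-involutive)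
open import Data.Fin using (Fin; zero; suc; toℕ; fromℕ<; inject≤; punchOut; opposite; splitAt; join)
open import Data.Fin.Properties
  using (_≟_; any?; toℕ<n; toℕ-injective; toℕ-fromℕ<; toℕ-inject≤; inject≤-injective; injective⇒≤;
         punchOut-injective; opposite-prop; opposite-involutive; splitAt-join; join-splitAt)
import Data.Fin.Permutation as Permutation
open import Data.Fin.Permutation.Components using (transpose)
open import Data.List using (List; []; _∷_; map; tabulate; allFin)
open import Data.List.Properties using (map-tabulate; map-cong)
open import Data.List.Relation.Unary.All using (All; []; _∷_)
open import Data.Nat using (ℕ; zero; suc; _+_; _*_; _∸_; _≤_; _<_; z≤n; s≤s; _<?_)
import Data.Nat.ListAction as List
open import Data.Nat.Properties
  using (+-0-commutativeMonoid; +-comm; +-identityʳ; +-mono-≤; +-mono-<-≤; +-mono-≤-<; +-monoʳ-≤;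
         ∸-monoʳ-≤; ∸-monoʳ-<; m+n∸n≡m; m+n∸m≡n; m+n≤o⇒m≤o∸n; m≤m+n; ≤-refl; <⇒≤; <⇒≱; ≮⇒≥;
         <-≤-trans; <-irrefl; <-asym; 1+n≰n; m<1+n⇒m<n∨m≡n)
open import Algebra.Properties.CommutativeMonoid.Sum +-0-commutativeMonoid
  using (sum-permute) renaming (sum to ∑)
open import Data.Product using (Σ; ∃; _×_; _,_; proj₁; proj₂)
open import Data.Sum as Sum using (_⊎_; inj₁; inj₂)
open import Data.Sum.Properties using (swap-involutive)
open import Function using (_∘_; id)
open import Function.Definitions using (Injective)
open import Relation.Binary.PropositionalEquality
open import Relation.Nullary using (Dec; does; yes; no; ¬_)
open import Relation.Nullary.Decidable using (dec-true; dec-false; _×-dec_; ¬?)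
open import Relation.Nullary.Negation using (contradiction)

open import Defs renaming (sym to adj-sym; irrefl to adj-irrefl)
open ≡-Reasoning

private variable n : ℕ

-- Counting

-- Stated with the list sum of Defs, so that deg G u is definitionally count (adj G u).
count : (Fin n → Bool) → ℕ
count {n} f = List.sum (map (λ j → if f j then 1 else 0) (allFin n))

count-cong : {f g : Fin n → Bool} → f ≗ g → count f ≡ count g
count-cong {n} f≗g = cong List.sum (map-cong (λ j → cong (λ b → if b then 1 else 0) (f≗g j)) (allFin n))

sum-tabulate : (f : Fin n → ℕ) → List.sum (tabulate f) ≡ ∑ f
sum-tabulate {zero}  f = refl
sum-tabulate {suc n} f = cong (f zero +_) (sum-tabulate (f ∘ suc))

count≡∑ : (f : Fin n → Bool) → count f ≡ ∑ (λ j → if f j then 1 else 0)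
count≡∑ {n} f = trans (cong List.sum (map-tabulate {n = n} id _)) (sum-tabulate {n} _)

∑-mono-≤ : {f g : Fin n → ℕ} → (∀ j → f j ≤ g j) → ∑ f ≤ ∑ g
∑-mono-≤ {zero}  f≤g = z≤n
∑-mono-≤ {suc n} f≤g = +-mono-≤ (f≤g zero) (∑-mono-≤ (f≤g ∘ suc))

∑-mono-< : {f g : Fin n → ℕ} → (∀ j → f j ≤ g j) → ∀ j → f j < g j → ∑ f < ∑ g
∑-mono-< f≤g zero    fj<gj = +-mono-<-≤ fj<gj (∑-mono-≤ (f≤g ∘ suc))
∑-mono-< f≤g (suc j) fj<gj = +-mono-≤-< (f≤g zero) (∑-mono-< (f≤g ∘ suc) j fj<gj)

count-mono-< : {f g : Fin n → Bool} → (∀ j → f j ≡ true → g j ≡ true) →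
  ∀ j → f j ≡ false → g j ≡ true → count f < count g
count-mono-< {f = f} {g} f⇒g j fj gj =
  subst₂ _<_ (sym (count≡∑ f)) (sym (count≡∑ g)) (∑-mono-< indicator-mono j indicator-<)
  where
  indicator-mono : ∀ j → (if f j then 1 else 0) ≤ (if g j then 1 else 0)
  indicator-mono j with f j in fj
  ... | false = z≤n
  ... | true rewrite f⇒g j fj = ≤-refl
  indicator-< : (if f j then 1 else 0) < (if g j then 1 else 0)
  indicator-< rewrite fj | gj = s≤s z≤n

transpose-matchˡ : (i j : Fin n) → transpose i j i ≡ j
transpose-matchˡ i j rewrite dec-true (i ≟ i) refl = refl

transpose-matchʳ : (i j : Fin n) → transpose i j j ≡ i
transpose-matchʳ i j with j ≟ i
... | yes j≡i = j≡i
... | no  _   rewrite dec-true (j ≟ j) refl = refl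

transpose-other : {i j k : Fin n} → k ≢ i → k ≢ j → transpose i j k ≡ k
transpose-other {i = i} {j} {k} k≢i k≢j rewrite dec-false (k ≟ i) k≢i | dec-false (k ≟ j) k≢j = refl

transpose-self : (i k : Fin n) → transpose i i k ≡ k
transpose-self i k = by-cases (k ≟ i)
  where
  by-cases : Dec (k ≡ i) → transpose i i k ≡ k
  by-cases (yes refl) = transpose-matchˡ k k
  by-cases (no k≢i)   = transpose-other k≢i k≢i

transpose-involutive : (i j k : Fin n) → transpose i j (transpose i j k) ≡ k
transpose-involutive i j k with k ≟ i
... | yes refl = transpose-matchʳ k j
... | no k≢i with k ≟ j
...   | yes refl = transpose-matchˡ i k
...   | no k≢j   = transpose-other k≢i k≢j

transpose-injective : (i j : Fin n) → Injective _≡_ _≡_ (transpose i j)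
transpose-injective i j {u} {v} eq =
  trans (sym (transpose-involutive i j u)) (trans (cong (transpose i j) eq) (transpose-involutive i j v))

count-transpose : (f : Fin n → Bool) (i j : Fin n) → count (f ∘ transpose i j) ≡ count f
count-transpose f i j = begin
  count (f ∘ transpose i j)                        ≡⟨ count≡∑ (f ∘ transpose i j) ⟩
  ∑ (λ k → if f (transpose i j k) then 1 else 0)   ≡⟨ sum-permute _ (Permutation.transpose i j) ⟨
  ∑ (λ k → if f k then 1 else 0)                   ≡⟨ count≡∑ f ⟨
  count f                                          ∎

⁅_,_⁆ : Fin n → Fin n → Fin n → Bool
⁅ x , y ⁆ v = does (v ≟ x) ∨ does (v ≟ y)

⁅,⁆-∋ˡ : (x y : Fin n) → ⁅ x , y ⁆ x ≡ true
⁅,⁆-∋ˡ x y rewrite dec-true (x ≟ x) refl = refl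

⁅,⁆-∋ʳ : (x y : Fin n) → ⁅ x , y ⁆ y ≡ true
⁅,⁆-∋ʳ x y rewrite dec-true (y ≟ y) refl = ∨-zeroʳ (does (y ≟ x))

⁅,⁆-∌ : {x y v : Fin n} → v ≢ x → v ≢ y → ⁅ x , y ⁆ v ≡ false
⁅,⁆-∌ {x = x} {y} {v} v≢x v≢y rewrite dec-false (v ≟ x) v≢x | dec-false (v ≟ y) v≢y = refl

⁅,⁆-disjoint : {a b c e : Fin n} → a ≢ b → a ≢ e → c ≢ b → c ≢ e →
  ∀ u → ⁅ a , c ⁆ u ∧ ⁅ b , e ⁆ u ≡ false
⁅,⁆-disjoint {a = a} {c = c} a≢b a≢e c≢b c≢e u with u ≟ a | u ≟ c
... | yes refl | _        = ⁅,⁆-∌ a≢b a≢e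
... | no _     | yes refl = ⁅,⁆-∌ c≢b c≢e
... | no _     | no _     = refl

⁅,⁆-xor≗transpose : (f : Fin n → Bool) {x y : Fin n} → f x ≡ not (f y) →
  (λ v → ⁅ x , y ⁆ v xor f v) ≗ f ∘ transpose x y
⁅,⁆-xor≗transpose f {x} {y} fx≡¬fy v with v ≟ x
... | yes refl = trans (cong not fx≡¬fy) (not-involutive (f y))
... | no v≢x with v ≟ y
...   | yes refl = sym fx≡¬fy
...   | no v≢y   = refl

-- Degree-preserving switches

edge⇒≢ : (G : Graph n) {u v : Fin n} → adj G u v ≡ true → u ≢ v
edge⇒≢ G {u} Guv refl with trans (sym Guv) (adj-irrefl G u)
... | ()

edge-nonedge⇒≢ : (G : Graph n) {u v w : Fin n} → adj G u v ≡ true → adj G u w ≡ false → v ≢ w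
edge-nonedge⇒≢ G Guv Guw refl with trans (sym Guv) Guw
... | ()

edge-subst : (G : Graph n) {u v u′ v′ : Fin n} → adj G u v ≡ true → u ≡ u′ → v ≡ v′ →
  adj G u′ v′ ≡ true
edge-subst G Guv refl refl = Guv

SameDegrees : Graph n → Graph n → Set
SameDegrees G G′ = ∀ u → deg G′ u ≡ deg G u

AgreeAwayFrom : List (Fin n) → Graph n → Graph n → Set
AgreeAwayFrom xs G G′ = ∀ {u v} → All (u ≢_) xs → All (v ≢_) xs → adj G′ u v ≡ adj G u v

_⊕_ : Graph n → Graph n → Graph n
K ⊕ G = record
  { adj    = λ u v → adj K u v xor adj G u v
  ; sym    = λ u v → cong₂ _xor_ (adj-sym K u v) (adj-sym G u v)
  ; irrefl = λ u → cong₂ _xor_ (adj-irrefl K u) (adj-irrefl G u)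
  }

deg-⊕-⁅,⁆ : (K G : Graph n) {u x y : Fin n} → adj K u ≗ ⁅ x , y ⁆ → adj G u x ≡ not (adj G u y) →
  deg (K ⊕ G) u ≡ deg G u
deg-⊕-⁅,⁆ K G {u} {x} {y} Ku Gu = begin
  count (λ v → adj K u v xor adj G u v)   ≡⟨ count-cong (λ v → cong (_xor adj G u v) (Ku v)) ⟩
  count (λ v → ⁅ x , y ⁆ v xor adj G u v) ≡⟨ count-cong (⁅,⁆-xor≗transpose (adj G u) Gu) ⟩
  count (adj G u ∘ transpose x y)         ≡⟨ count-transpose (adj G u) x y ⟩
  count (adj G u)                         ∎

deg-⊕-isolated : (K G : Graph n) {u : Fin n} → (∀ v → adj K u v ≡ false) → deg (K ⊕ G) u ≡ deg G u
deg-⊕-isolated K G {u} Ku = count-cong (λ v → cong (_xor adj G u v) (Ku v))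

module Biclique (A B : Fin n → Bool) (disjoint : ∀ u → A u ∧ B u ≡ false) where

  graph : Graph n
  graph = record
    { adj    = λ u v → (A u ∧ B v) ∨ (B u ∧ A v)
    ; sym    = λ u v → trans (∨-comm (A u ∧ B v) (B u ∧ A v))
                             (cong₂ _∨_ (∧-comm (B u) (A v)) (∧-comm (A u) (B v)))
    ; irrefl = λ u → cong₂ _∨_ (disjoint u) (trans (∧-comm (B u) (A u)) (disjoint u))
    }

  rowᴬ : ∀ u → A u ≡ true → adj graph u ≗ B
  rowᴬ u Au v with disjoint u
  ... | AuBu rewrite Au | AuBu = ∨-identityʳ (B v)

  rowᴮ : ∀ u → B u ≡ true → adj graph u ≗ A
  rowᴮ u Bu v with trans (∧-comm (B u) (A u)) (disjoint u)
  ... | BuAu rewrite Bu | BuAu = refl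

  isolated : ∀ u → A u ≡ false → B u ≡ false → ∀ v → adj graph u v ≡ false
  isolated u Au Bu v rewrite Au | Bu = refl

  awayᴬ : ∀ u v → A u ≡ false → A v ≡ false → adj graph u v ≡ false
  awayᴬ u v Au Av rewrite Au | Av = ∧-zeroʳ (B u)

  awayᴮ : ∀ u v → B u ≡ false → B v ≡ false → adj graph u v ≡ false
  awayᴮ u v Bu Bv rewrite Bu | Bv = trans (∨-identityʳ _) (∧-zeroʳ (A u))

module _ (H : Graph n) {a b c e : Fin n}
  (Hab : adj H a b ≡ true) (Hce : adj H c e ≡ true) (Hbc : adj H b c ≡ false) (Hea : adj H e a ≡ false)
  (a≢e : a ≢ e) (b≢c : b ≢ c) where

  two-switch : Σ (Graph n) λ H′ → SameDegrees H H′ × adj H′ b c ≡ true × adj H′ e a ≡ true ×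
    AgreeAwayFrom (a ∷ c ∷ []) H H′ × AgreeAwayFrom (b ∷ e ∷ []) H H′
  two-switch = C ⊕ H , same-degrees , bc , ea , agreeᴬ , agreeᴮ
    where
    -- C is the 4-cycle a b c e: in C ⊕ H each of its vertices trades one neighbour for another.
    open Biclique ⁅ a , c ⁆ ⁅ b , e ⁆ (⁅,⁆-disjoint (edge⇒≢ H Hab) a≢e (b≢c ∘ sym) (edge⇒≢ H Hce))
      renaming (graph to C)
    same-degrees : SameDegrees H (C ⊕ H)
    same-degrees u = by-cases (u ≟ a) (u ≟ c) (u ≟ b) (u ≟ e)
      where
      by-cases : Dec (u ≡ a) → Dec (u ≡ c) → Dec (u ≡ b) → Dec (u ≡ e) → deg (C ⊕ H) u ≡ deg H u
      by-cases (yes refl) _ _ _ =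
        deg-⊕-⁅,⁆ C H (rowᴬ a (⁅,⁆-∋ˡ a c)) (trans Hab (cong not (sym (trans (adj-sym H a e) Hea))))
      by-cases (no _) (yes refl) _ _ =
        deg-⊕-⁅,⁆ C H (rowᴬ c (⁅,⁆-∋ʳ a c)) (trans (trans (adj-sym H c b) Hbc) (cong not (sym Hce)))
      by-cases (no _) (no _) (yes refl) _ =
        deg-⊕-⁅,⁆ C H (rowᴮ b (⁅,⁆-∋ˡ b e)) (trans (trans (adj-sym H b a) Hab) (cong not (sym Hbc)))
      by-cases (no _) (no _) (no _) (yes refl) =
        deg-⊕-⁅,⁆ C H (rowᴮ e (⁅,⁆-∋ʳ b e)) (trans Hea (cong not (sym (trans (adj-sym H e c) Hce))))
      by-cases (no u≢a) (no u≢c) (no u≢b) (no u≢e) =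
        deg-⊕-isolated C H (isolated u (⁅,⁆-∌ u≢a u≢c) (⁅,⁆-∌ u≢b u≢e))
    bc : adj (C ⊕ H) b c ≡ true
    bc = cong₂ _xor_ (trans (rowᴮ b (⁅,⁆-∋ˡ b e) c) (⁅,⁆-∋ʳ a c)) Hbc
    ea : adj (C ⊕ H) e a ≡ true
    ea = cong₂ _xor_ (trans (rowᴮ e (⁅,⁆-∋ʳ b e) a) (⁅,⁆-∋ˡ a c)) Hea
    agreeᴬ : AgreeAwayFrom (a ∷ c ∷ []) H (C ⊕ H)
    agreeᴬ {u} {v} (u≢a ∷ u≢c ∷ []) (v≢a ∷ v≢c ∷ []) =
      cong (_xor adj H u v) (awayᴬ u v (⁅,⁆-∌ u≢a u≢c) (⁅,⁆-∌ v≢a v≢c))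
    agreeᴮ : AgreeAwayFrom (b ∷ e ∷ []) H (C ⊕ H)
    agreeᴮ {u} {v} (u≢b ∷ u≢e ∷ []) (v≢b ∷ v≢e ∷ []) =
      cong (_xor adj H u v) (awayᴮ u v (⁅,⁆-∌ u≢b u≢e) (⁅,⁆-∌ v≢b v≢e))

-- Without such a w, N(x) ∖ {y} ⊆ N(y) while z ∈ N(y) ∖ N(x): the row of x lies strictly below the row
-- of y with x and y transposed, so deg x < deg y.
private-neighbour : (H : Graph n) {x y z : Fin n} → x ≢ y → z ≢ x →
  adj H y z ≡ true → adj H x z ≡ false → deg H y ≤ deg H x →
  Σ (Fin n) λ w → adj H x w ≡ true × adj H y w ≡ false × w ≢ y
private-neighbour H {x} {y} {z} x≢y z≢x Hyz Hxz dy≤dx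
  with any? (λ w → (adj H x w Bool.≟ true) ×-dec (adj H y w Bool.≟ false) ×-dec ¬? (w ≟ y))
... | yes found = found
... | no none = contradiction dy≤dx (<⇒≱ (subst (deg H x <_) (count-transpose (adj H y) x y) dx<dy))
  where
  x⇒y : ∀ j → adj H x j ≡ true → adj H y (transpose x y j) ≡ true
  x⇒y j Hxj with j ≟ x
  ... | yes refl = contradiction refl (edge⇒≢ H Hxj)
  ... | no j≢x with j ≟ y
  ...   | yes refl = trans (adj-sym H j x) Hxj
  ...   | no j≢y with adj H y j in Hyj
  ...     | true  = refl
  ...     | false = contradiction (j , Hxj , Hyj , j≢y) none
  dx<dy : deg H x < count (adj H y ∘ transpose x y)
  dx<dy = count-mono-< x⇒y z Hxz (trans (cong (adj H y) (transpose-other z≢x (edge⇒≢ H Hyz ∘ sym))) Hyz)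

transfer-edge : (H : Graph n) {x y z : Fin n} → x ≢ y → z ≢ x → adj H y z ≡ true → deg H y ≤ deg H x →
  Σ (Graph n) λ H′ → SameDegrees H H′ × adj H′ x z ≡ true × AgreeAwayFrom (x ∷ y ∷ []) H H′ ×
    (∀ {u} → u ≢ z → adj H y u ≡ true → adj H′ y u ≡ true)
transfer-edge H {x} {y} {z} x≢y z≢x Hyz dy≤dx with adj H x z in Hxz
... | true  = H , (λ _ → refl) , Hxz , (λ _ _ → refl) , (λ _ Hyu → Hyu)
... | false with w , Hxw , Hyw , w≢y ← private-neighbour H x≢y z≢x Hyz Hxz dy≤dx
  with H′ , same-degrees , _ , xz , agree-zw , agree-yx ←
         two-switch H (trans (adj-sym H z y) Hyz) (trans (adj-sym H w x) Hxw) Hyw Hxz z≢x (w≢y ∘ sym)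
  = H′ , same-degrees , xz ,
    (λ { (u≢x ∷ u≢y ∷ []) (v≢x ∷ v≢y ∷ []) →
           agree-yx (u≢y ∷ u≢x ∷ []) (v≢y ∷ v≢x ∷ []) }) ,
    (λ u≢z Hyu →
       trans (agree-zw (edge⇒≢ H Hyz ∷ w≢y ∘ sym ∷ []) (u≢z ∷ edge-nonedge⇒≢ H Hyu Hyw ∷ [])) Hyu)

rematch : (H : Graph n) {k a t b : Fin n} → k ≢ t → k ≢ b → a ≢ t → a ≢ b →
  adj H k a ≡ true → adj H t b ≡ true → deg H b ≤ deg H k → deg H t ≤ deg H a →
  Σ (Graph n) λ H′ → SameDegrees H H′ × adj H′ k t ≡ true × adj H′ a b ≡ true ×
    AgreeAwayFrom (k ∷ a ∷ t ∷ b ∷ []) H H′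
rematch H {k} {a} {t} {b} k≢t k≢b a≢t a≢b Hka Htb db≤dk dt≤da with adj H a b in Hab | adj H k t in Hkt
... | true | _
  with H′ , same-degrees , kt , agree , keeps ←
         transfer-edge H k≢b (k≢t ∘ sym) (trans (adj-sym H b t) Htb) db≤dk
  = H′ , same-degrees , kt , trans (adj-sym H′ a b) (keeps a≢t (trans (adj-sym H b a) Hab)) ,
    λ { (u≢k ∷ _ ∷ _ ∷ u≢b ∷ []) (v≢k ∷ _ ∷ _ ∷ v≢b ∷ []) →
          agree (u≢k ∷ u≢b ∷ []) (v≢k ∷ v≢b ∷ []) }
... | false | true
  with H′ , same-degrees , ab , agree , keeps ← transfer-edge H a≢t (a≢b ∘ sym) Htb dt≤da
  = H′ , same-degrees , trans (adj-sym H′ k t) (keeps k≢b (trans (adj-sym H t k) Hkt)) , ab ,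
    λ { (_ ∷ u≢a ∷ u≢t ∷ _ ∷ []) (_ ∷ v≢a ∷ v≢t ∷ _ ∷ []) →
          agree (u≢a ∷ u≢t ∷ []) (v≢a ∷ v≢t ∷ []) }
... | false | false
  with H′ , same-degrees , ab , tk , agree , _ ←
         two-switch H Hka (trans (adj-sym H b t) Htb) Hab (trans (adj-sym H t k) Hkt) k≢t a≢b
  = H′ , same-degrees , trans (adj-sym H′ k t) tk , ab ,
    λ { (u≢k ∷ _ ∷ _ ∷ u≢b ∷ []) (v≢k ∷ _ ∷ _ ∷ v≢b ∷ []) →
          agree (u≢k ∷ u≢b ∷ []) (v≢k ∷ v≢b ∷ []) }

deg-antitone : {d : Fin n → ℕ} → NonIncreasing d → (G : Graph n) → Realizes G d →
  {u v : Fin n} → toℕ u ≤ toℕ v → deg G v ≤ deg G u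
deg-antitone d-antitone G realizes {u} {v} u≤v =
  subst₂ _≤_ (sym (realizes v)) (sym (realizes u)) (d-antitone u v u≤v)

-- Pigeonhole

injective⇒surjective : ∀ {m} {f : Fin m → Fin m} → Injective _≡_ _≡_ f → ∀ y → ∃ λ x → f x ≡ y
injective⇒surjective {suc m} {f} f-injective y with any? (λ x → f x ≟ y)
... | yes hit = hit
... | no  miss = contradiction (injective⇒≤ punchOut∘f-injective) 1+n≰n
  where
  y≢f : ∀ x → y ≢ f x
  y≢f x y≡fx = miss (x , sym y≡fx)
  punchOut∘f-injective : Injective _≡_ _≡_ (λ x → punchOut (y≢f x))
  punchOut∘f-injective = f-injective ∘ punchOut-injective (y≢f _) (y≢f _)

free-low-vertex : ∀ {m} (g : Fin m → Fin n) → Injective _≡_ _≡_ g → (p : Fin m) → m ≤ toℕ (g p) →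
  ∃ λ x → toℕ x < m × ∀ q → g q ≢ x
free-low-vertex {n} {m} g g-injective p m≤gp = decide (any? (λ i → ¬? (any? (λ q → g q ≟ ι i))))
  where
  ι : Fin m → Fin n
  ι i = inject≤ i (injective⇒≤ g-injective)
  ι-low : ∀ i → toℕ (ι i) < m
  ι-low i = subst (_< m) (sym (toℕ-inject≤ i _)) (toℕ<n i)
  decide : Dec (∃ λ i → ¬ ∃ λ q → g q ≡ ι i) → ∃ λ x → toℕ x < m × ∀ q → g q ≢ x
  decide (yes (i , unhit)) = ι i , ι-low i , λ q gq≡ιi → unhit (q , gq≡ιi)
  decide (no all-hit) = contradiction m≤gp (<⇒≱ (subst (λ v → toℕ v < m) ιi≡gp (ι-low (proj₁ hit))))
    where
    preimage : ∀ i → ∃ λ q → g q ≡ ι i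
    preimage i with any? (λ q → g q ≟ ι i)
    ... | yes hit  = hit
    ... | no unhit = contradiction (i , unhit) all-hit
    preimage-injective : Injective _≡_ _≡_ (proj₁ ∘ preimage)
    preimage-injective {i} {j} eq = inject≤-injective _ _ i j
      (trans (sym (proj₂ (preimage i))) (trans (cong g eq) (proj₂ (preimage j))))
    hit : ∃ λ i → proj₁ (preimage i) ≡ p
    hit = injective⇒surjective preimage-injective p
    ιi≡gp : ι (proj₁ hit) ≡ g p
    ιi≡gp = trans (sym (proj₂ (preimage (proj₁ hit)))) (cong g (proj₂ hit))

-- Matched realizations

module Matchings (d : Fin n → ℕ) {m : ℕ}
  (partner : Fin m → Fin m) (partner-involutive : Involutive _≡_ partner) where

  -- Slots hold arbitrary vertices (ι = id) or, once confined to the first m vertices, elements of Fin m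
  -- (ι = inject≤).
  record MatchedRealization {V : Set} (ι : V → Fin n) : Set where
    field
      graph          : Graph n
      realizes       : Realizes graph d
      slot           : Fin m → V
      slot-injective : Injective _≡_ _≡_ slot
      slot-edge      : ∀ p → adj graph (ι (slot p)) (ι (slot (partner p))) ≡ true

  module MR = MatchedRealization

  partner-injective : Injective _≡_ _≡_ partner
  partner-injective {p} {q} eq = trans (sym (partner-involutive p)) (trans (cong partner eq) (partner-involutive q))

  partner-flip : ∀ {p q} → partner p ≡ q → p ≡ partner q
  partner-flip {p} p′≡q = trans (sym (partner-involutive p)) (cong partner p′≡q)

  partner-adjacent : (H : Graph n) (f : Fin m → Fin n) {p : Fin m} →
    adj H (f p) (f (partner p)) ≡ true → adj H (f (partner p)) (f (partner (partner p))) ≡ true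
  partner-adjacent H f {p} e =
    subst (λ p″ → adj H (f (partner p)) (f p″) ≡ true) (sym (partner-involutive p)) (trans (adj-sym H _ _) e)

  module _ {V : Set} {ι : V → Fin n} (S : MatchedRealization ι) where
    open MatchedRealization S

    slot-≢ : ∀ {p q} → p ≢ q → slot p ≢ slot q
    slot-≢ p≢q = p≢q ∘ slot-injective

    partner-≢ : ∀ p → partner p ≢ p
    partner-≢ p p′≡p = edge⇒≢ graph (slot-edge p) (cong (ι ∘ slot) (sym p′≡p))

  relabel : ∀ {V} {ι : V → Fin n} (S : MatchedRealization ι) (H′ : Graph n) → SameDegrees (MR.graph S) H′ →
    (σ : V → V) → Injective _≡_ _≡_ σ →
    (∀ p → adj H′ (ι (σ (MR.slot S p))) (ι (σ (MR.slot S (partner p)))) ≡ true) → MatchedRealization ι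
  relabel S H′ same-degrees σ σ-injective edges = record
    { graph          = H′
    ; realizes       = λ u → trans (same-degrees u) (MR.realizes S u)
    ; slot           = σ ∘ MR.slot S
    ; slot-injective = MR.slot-injective S ∘ σ-injective
    ; slot-edge      = edges
    }

  module _ (d-antitone : NonIncreasing d) (S : MatchedRealization id) where
    open MatchedRealization S

    replace-slot : (s : Fin m) {x : Fin n} → (∀ p → slot p ≢ x) → toℕ x ≤ toℕ (slot s) →
      Σ (MatchedRealization id) λ S′ → MR.slot S′ s ≡ x × ∀ p → p ≢ s → MR.slot S′ p ≡ slot p
    replace-slot s {x} x-free x≤y
      with H′ , same-degrees , xz , agree , _ ←
             transfer-edge graph (x-free s ∘ sym) (x-free (partner s)) (slot-edge s)
               (deg-antitone d-antitone graph realizes x≤y)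
      = relabel S H′ same-degrees σ (transpose-injective x y) edge ,
        transpose-matchʳ x y ,
        λ p → σ-fixes {p}
      where
      y = slot s
      σ = transpose x y
      σ-fixes : ∀ {p} → p ≢ s → σ (slot p) ≡ slot p
      σ-fixes {p} p≢s = transpose-other (x-free p) (slot-≢ S p≢s)
      edge-s : adj H′ (σ (slot s)) (σ (slot (partner s))) ≡ true
      edge-s = edge-subst H′ xz (sym (transpose-matchʳ x y)) (sym (σ-fixes (partner-≢ S s)))
      edge : ∀ p → adj H′ (σ (slot p)) (σ (slot (partner p))) ≡ true
      edge p with p ≟ s | p ≟ partner s
      ... | yes refl | _        = edge-s
      ... | no _     | yes refl = partner-adjacent H′ (σ ∘ slot) edge-s
      ... | no p≢s   | no p≢s′  =
        edge-subst H′ (trans (agree (x-free p ∷ slot-≢ S p≢s ∷ [])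
                                    (x-free (partner p) ∷ slot-≢ S p′≢s ∷ []))
                             (slot-edge p))
          (sym (σ-fixes p≢s)) (sym (σ-fixes p′≢s))
        where
        p′≢s : partner p ≢ s
        p′≢s = p≢s′ ∘ partner-flip

  module _ {v : ℕ} {ι : Fin v → Fin n} (ι-injective : Injective _≡_ _≡_ ι) (S : MatchedRealization ι) where
    open MatchedRealization S

    vertex-≢ : ∀ {p q} → p ≢ q → ι (slot p) ≢ ι (slot q)
    vertex-≢ p≢q = slot-≢ S p≢q ∘ ι-injective

    rematch-slots : ∀ {q r} → r ≢ q → r ≢ partner q →
      deg graph (ι (slot (partner r))) ≤ deg graph (ι (slot q)) →
      deg graph (ι (slot r)) ≤ deg graph (ι (slot (partner q))) →
      Σ (MatchedRealization ι) λ S′ → ∀ p → MR.slot S′ p ≡ transpose (slot (partner q)) (slot r) (slot p)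
    rematch-slots {q} {r} r≢q r≢q′ db≤dk dt≤da
      with H′ , same-degrees , kt , ab , agree ←
             rematch graph (vertex-≢ (r≢q ∘ sym)) (vertex-≢ (r≢q′ ∘ partner-flip ∘ sym))
                           (vertex-≢ (r≢q′ ∘ sym)) (vertex-≢ (r≢q ∘ sym ∘ partner-injective))
                           (slot-edge q) (slot-edge r) db≤dk dt≤da
      = relabel S H′ same-degrees σ (transpose-injective a t) edge , λ _ → refl
      where
      a = slot (partner q)
      t = slot r
      σ = transpose a t
      σ-fixes : ∀ {p} → p ≢ partner q → p ≢ r → σ (slot p) ≡ slot p
      σ-fixes p≢q′ p≢r = transpose-other (slot-≢ S p≢q′) (slot-≢ S p≢r)
      Edge : Fin m → Set
      Edge p = adj H′ (ι (σ (slot p))) (ι (σ (slot (partner p)))) ≡ true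
      edge-q : Edge q
      edge-q = edge-subst H′ kt (cong ι (sym (σ-fixes (partner-≢ S q ∘ sym) (r≢q ∘ sym))))
                                (cong ι (sym (transpose-matchˡ a t)))
      edge-r : Edge r
      edge-r = edge-subst H′ ab (cong ι (sym (transpose-matchʳ a t)))
                                (cong ι (sym (σ-fixes (r≢q ∘ sym ∘ partner-injective ∘ sym) (partner-≢ S r))))
      edge : ∀ p → Edge p
      edge p with p ≟ q | p ≟ r | p ≟ partner q | p ≟ partner r
      ... | yes refl | _        | _        | _        = edge-q
      ... | no _     | yes refl | _        | _        = edge-r
      ... | no _     | no _     | yes refl | _        = partner-adjacent H′ (ι ∘ σ ∘ slot) edge-q
      ... | no _     | no _     | no _     | yes refl = partner-adjacent H′ (ι ∘ σ ∘ slot) edge-r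
      ... | no p≢q   | no p≢r   | no p≢q′  | no p≢r′  =
        edge-subst H′
          (trans (agree (vertex-≢ p≢q ∷ vertex-≢ p≢q′ ∷ vertex-≢ p≢r ∷ vertex-≢ p≢r′ ∷ [])
                        (vertex-≢ p′≢q ∷ vertex-≢ p′≢q′ ∷ vertex-≢ p′≢r ∷ vertex-≢ p′≢r′ ∷ []))
                 (slot-edge p))
          (cong ι (sym (σ-fixes p≢q′ p≢r))) (cong ι (sym (σ-fixes p′≢q′ p′≢r)))
        where
        p′≢q : partner p ≢ q
        p′≢q = p≢q′ ∘ partner-flip
        p′≢r : partner p ≢ r
        p′≢r = p≢r′ ∘ partner-flip
        p′≢q′ : partner p ≢ partner q
        p′≢q′ = p≢q ∘ partner-injective
        p′≢r′ : partner p ≢ partner r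
        p′≢r′ = p≢r ∘ partner-injective

  -- Packing the matching into the first m vertices

  LowBelow : ℕ → MatchedRealization id → Set
  LowBelow j S = ∀ p → toℕ p < j → toℕ (MR.slot S p) < m

  extend-prefix : ∀ {j} {P : Fin m → Set} (j<m : j < m) →
    (∀ p → toℕ p < j → P p) → P (fromℕ< j<m) → ∀ p → toℕ p < suc j → P p
  extend-prefix {P = P} j<m below at p p<1+j with m<1+n⇒m<n∨m≡n p<1+j
  ... | inj₁ p<j = below p p<j
  ... | inj₂ p≡j = subst P (toℕ-injective (trans (toℕ-fromℕ< j<m) (sym p≡j))) at

  module _ (d-antitone : NonIncreasing d) where

    pack-one : ∀ {j} (j<m : j < m) (S : MatchedRealization id) → LowBelow j S →
      Σ (MatchedRealization id) (LowBelow (suc j))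
    pack-one {j} j<m S low with toℕ (MR.slot S (fromℕ< j<m)) <? m
    ... | yes s-low = S , extend-prefix j<m low s-low
    ... | no  s-high
      with x , x<m , x-free ← free-low-vertex (MR.slot S) (MR.slot-injective S) _ (≮⇒≥ s-high)
      with S′ , slot-s , unchanged ← replace-slot d-antitone S _ x-free (<⇒≤ (<-≤-trans x<m (≮⇒≥ s-high)))
      = S′ , extend-prefix j<m
               (λ p p<j → subst (λ v → toℕ v < m) (sym (unchanged p (p≢s p<j))) (low p p<j))
               (subst (λ v → toℕ v < m) (sym slot-s) x<m)
      where
      p≢s : ∀ {p} → toℕ p < j → p ≢ fromℕ< j<m
      p≢s p<j refl = <-irrefl (toℕ-fromℕ< j<m) p<j

    pack-prefix : (S : MatchedRealization id) → ∀ j → j ≤ m → Σ (MatchedRealization id) (LowBelow j)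
    pack-prefix S zero    _   = S , λ _ ()
    pack-prefix S (suc j) j<m with S′ , low ← pack-prefix S j (<⇒≤ j<m) = pack-one j<m S′ low

    pack : MatchedRealization id → Σ (MatchedRealization id) λ S → ∀ p → toℕ (MR.slot S p) < m
    pack S with S′ , low ← pack-prefix S m ≤-refl = S′ , λ p → low p (toℕ<n p)

  lower-slots : (S : MatchedRealization id) → (∀ p → toℕ (MR.slot S p) < m) → (m≤n : m ≤ n) →
    MatchedRealization (λ i → inject≤ i m≤n)
  lower-slots S low m≤n = record
    { graph          = MR.graph S
    ; realizes       = MR.realizes S
    ; slot           = λ p → fromℕ< (low p)
    ; slot-injective = λ {p} {q} eq →
        MR.slot-injective S (trans (sym (lowered p)) (trans (cong (λ i → inject≤ i m≤n) eq) (lowered q)))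
    ; slot-edge      = λ p →
        edge-subst (MR.graph S) (MR.slot-edge S p) (sym (lowered p)) (sym (lowered (partner p)))
    }
    where
    lowered : ∀ p → inject≤ (fromℕ< (low p)) m≤n ≡ MR.slot S p
    lowered p = toℕ-injective (trans (toℕ-inject≤ _ m≤n) (toℕ-fromℕ< (low p)))

-- Sorting the matching edges

opposite-antitone : ∀ {m} {i j : Fin m} → toℕ i ≤ toℕ j → toℕ (opposite j) ≤ toℕ (opposite i)
opposite-antitone {m} {i} {j} i≤j =
  subst₂ _≤_ (sym (opposite-prop j)) (sym (opposite-prop i)) (∸-monoʳ-≤ m (s≤s i≤j))

-- opposite i (of value 2ν − 1 − i) is the paper's mirror image 2ν − i + 1, shifted to 0-indexing.
module Sorting (d : Fin n → ℕ) (d-antitone : NonIncreasing d) {ν : ℕ} (2ν≤n : ν + ν ≤ n)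
  (partner : Fin (ν + ν) → Fin (ν + ν)) (partner-involutive : Involutive _≡_ partner) where

  open Matchings d partner partner-involutive public

  ι : Fin (ν + ν) → Fin n
  ι i = inject≤ i 2ν≤n

  ι-injective : Injective _≡_ _≡_ ι
  ι-injective = inject≤-injective _ _ _ _

  Fixed : ℕ → Fin (ν + ν) → Set
  Fixed k x = toℕ x < k ⊎ toℕ (opposite x) < k

  MirroredUpTo : ℕ → MatchedRealization ι → Set
  MirroredUpTo k S = ∀ p → Fixed k (MR.slot S p) → MR.slot S (partner p) ≡ opposite (MR.slot S p)

  deg-ι-antitone : (S : MatchedRealization ι) {x y : Fin (ν + ν)} → toℕ x ≤ toℕ y →
    deg (MR.graph S) (ι y) ≤ deg (MR.graph S) (ι x)
  deg-ι-antitone S {x} {y} x≤y = deg-antitone d-antitone (MR.graph S) (MR.realizes S)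
    (subst₂ _≤_ (sym (toℕ-inject≤ x 2ν≤n)) (sym (toℕ-inject≤ y 2ν≤n)) x≤y)

  slot-surjective : (S : MatchedRealization ι) → ∀ x → ∃ λ p → MR.slot S p ≡ x
  slot-surjective S = injective⇒surjective (MR.slot-injective S)

  fixed-opposite : ∀ {k x} → Fixed k x → Fixed k (opposite x)
  fixed-opposite {x = x} (inj₁ x<k) = inj₂ (subst (λ y → toℕ y < _) (sym (opposite-involutive x)) x<k)
  fixed-opposite         (inj₂ x′<k) = inj₁ x′<k

  all-fixed : ∀ x → Fixed ν x
  all-fixed x with toℕ x <? ν
  ... | yes x<ν = inj₁ x<ν
  ... | no  x≮ν = inj₂ (subst₂ _<_ (sym (opposite-prop x)) (m+n∸n≡m ν ν)
                                   (∸-monoʳ-< (s≤s (≮⇒≥ x≮ν)) (toℕ<n x)))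

  module _ {k : ℕ} (k<ν : k < ν) where

    kᶠ : Fin (ν + ν)
    kᶠ = fromℕ< (<-≤-trans k<ν (m≤m+n ν ν))

    k<opposite-kᶠ : k < toℕ (opposite kᶠ)
    k<opposite-kᶠ = <-≤-trans k<ν (subst (ν ≤_) (sym (opposite-prop kᶠ))
      (m+n≤o⇒m≤o∸n ν (subst (λ i → ν + suc i ≤ ν + ν) (sym (toℕ-fromℕ< _)) (+-monoʳ-≤ ν k<ν))))

    kᶠ-unfixed : ¬ Fixed k kᶠ
    kᶠ-unfixed (inj₁ kᶠ<k)  = <-irrefl (toℕ-fromℕ< _) kᶠ<k
    kᶠ-unfixed (inj₂ kᶠ′<k) = <-asym kᶠ′<k k<opposite-kᶠ

    fixed-suc : ∀ {x} → Fixed (suc k) x → Fixed k x ⊎ x ≡ kᶠ ⊎ x ≡ opposite kᶠ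
    fixed-suc (inj₁ x<1+k) with m<1+n⇒m<n∨m≡n x<1+k
    ... | inj₁ x<k = inj₁ (inj₁ x<k)
    ... | inj₂ x≡k = inj₂ (inj₁ (toℕ-injective (trans x≡k (sym (toℕ-fromℕ< _)))))
    fixed-suc {x} (inj₂ x′<1+k) with m<1+n⇒m<n∨m≡n x′<1+k
    ... | inj₁ x′<k = inj₁ (inj₂ x′<k)
    ... | inj₂ x′≡k = inj₂ (inj₂ (trans (sym (opposite-involutive x))
                                        (cong opposite (toℕ-injective (trans x′≡k (sym (toℕ-fromℕ< _)))))))

    module _ (S : MatchedRealization ι) (mirrored : MirroredUpTo k S) {q r : Fin (ν + ν)}
      (slot-q : MR.slot S q ≡ kᶠ) (slot-r : MR.slot S r ≡ opposite kᶠ) where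
      open MatchedRealization S

      private
        a = slot (partner q)
        t = slot r
        σ = transpose a t

      partner-unfixed : ∀ {p} → ¬ Fixed k (slot p) → ¬ Fixed k (slot (partner p))
      partner-unfixed {p} unfixed fixed′ = unfixed (subst (Fixed k)
        (trans (sym (mirrored (partner p) fixed′)) (cong slot (partner-involutive p))) (fixed-opposite fixed′))

      k-unfixed : ¬ Fixed k (slot q)
      k-unfixed = subst (λ x → ¬ Fixed k x) (sym slot-q) kᶠ-unfixed

      t-unfixed : ¬ Fixed k t
      t-unfixed fixed =
        kᶠ-unfixed (subst (Fixed k) (opposite-involutive kᶠ) (fixed-opposite (subst (Fixed k) slot-r fixed)))

      k≢t : slot q ≢ t
      k≢t k≡t = <-irrefl (trans (sym (toℕ-fromℕ< _)) (cong toℕ (trans (sym slot-q) (trans k≡t slot-r))))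
                         k<opposite-kᶠ

      σ-fixes : ∀ {x} → Fixed k x → σ x ≡ x
      σ-fixes fixed =
        transpose-other (λ { refl → partner-unfixed k-unfixed fixed }) (λ { refl → t-unfixed fixed })

      σ-k : σ (slot q) ≡ slot q
      σ-k = transpose-other (slot-≢ S (partner-≢ S q ∘ sym)) k≢t

      mirrored-after : (S′ : MatchedRealization ι) → (∀ p → MR.slot S′ p ≡ σ (slot p)) →
        MirroredUpTo (suc k) S′
      mirrored-after S′ relabelled p fixed′ = by-cases (fixed-suc fixed′)
        where
        y = MR.slot S′ p
        slot-p : slot p ≡ σ y
        slot-p = trans (sym (transpose-involutive a t (slot p))) (cong σ (sym (relabelled p)))
        by-cases : Fixed k y ⊎ y ≡ kᶠ ⊎ y ≡ opposite kᶠ → MR.slot S′ (partner p) ≡ opposite y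
        by-cases (inj₁ fixed) = begin
          MR.slot S′ (partner p)  ≡⟨ relabelled (partner p) ⟩
          σ (slot (partner p))    ≡⟨ cong σ (mirrored p fixed-p) ⟩
          σ (opposite (slot p))   ≡⟨ σ-fixes (fixed-opposite fixed-p) ⟩
          opposite (slot p)       ≡⟨ cong opposite slot-p≡y ⟩
          opposite y              ∎
          where
          slot-p≡y : slot p ≡ y
          slot-p≡y = trans slot-p (σ-fixes fixed)
          fixed-p : Fixed k (slot p)
          fixed-p = subst (Fixed k) (sym slot-p≡y) fixed
        by-cases (inj₂ (inj₁ y≡k)) = begin
          MR.slot S′ (partner p)  ≡⟨ relabelled (partner p) ⟩
          σ (slot (partner p))    ≡⟨ cong (σ ∘ slot ∘ partner) p≡q ⟩
          σ a                     ≡⟨ transpose-matchˡ a t ⟩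
          t                       ≡⟨ slot-r ⟩
          opposite kᶠ             ≡⟨ cong opposite y≡k ⟨
          opposite y              ∎
          where
          p≡q : p ≡ q
          p≡q = slot-injective (trans slot-p (trans (cong σ (trans y≡k (sym slot-q))) σ-k))
        by-cases (inj₂ (inj₂ y≡t)) = begin
          MR.slot S′ (partner p)  ≡⟨ relabelled (partner p) ⟩
          σ (slot (partner p))    ≡⟨ cong (σ ∘ slot) (trans (cong partner p≡q′) (partner-involutive q)) ⟩
          σ (slot q)              ≡⟨ σ-k ⟩
          slot q                  ≡⟨ slot-q ⟩
          kᶠ                      ≡⟨ opposite-involutive kᶠ ⟨
          opposite (opposite kᶠ)  ≡⟨ cong opposite y≡t ⟨
          opposite y              ∎
          where
          p≡q′ : p ≡ partner q
          p≡q′ = slot-injective (trans slot-p (trans (cong σ (trans y≡t (sym slot-r))) (transpose-matchʳ a t)))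

      -- The partners of kᶠ and of its mirror image are not fixed, hence lie between the two.
      deg-b≤deg-k : deg graph (ι (slot (partner r))) ≤ deg graph (ι (slot q))
      deg-b≤deg-k = deg-ι-antitone S
        (subst (_≤ toℕ (slot (partner r))) (sym (trans (cong toℕ slot-q) (toℕ-fromℕ< _)))
               (≮⇒≥ (partner-unfixed t-unfixed ∘ inj₁)))

      deg-t≤deg-a : deg graph (ι t) ≤ deg graph (ι a)
      deg-t≤deg-a = deg-ι-antitone S
        (subst₂ _≤_ (cong toℕ (opposite-involutive a)) (cong toℕ (trans (cong opposite slot-q) (sym slot-r)))
                    (opposite-antitone k≤a′))
        where
        k≤a′ : toℕ (slot q) ≤ toℕ (opposite a)
        k≤a′ = subst (_≤ toℕ (opposite a)) (sym (trans (cong toℕ slot-q) (toℕ-fromℕ< _)))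
                     (≮⇒≥ (partner-unfixed k-unfixed ∘ inj₂))

      sort-pair : Σ (MatchedRealization ι) (MirroredUpTo (suc k))
      sort-pair with r ≟ partner q
      ... | yes refl = S , mirrored-after S (λ p → sym (transpose-self a (slot p)))
      ... | no r≢q′
        with S′ , relabelled ←
               rematch-slots ι-injective S (k≢t ∘ cong slot ∘ sym) r≢q′ deg-b≤deg-k deg-t≤deg-a
        = S′ , mirrored-after S′ relabelled

    sort-step : (S : MatchedRealization ι) → MirroredUpTo k S →
      Σ (MatchedRealization ι) (MirroredUpTo (suc k))
    sort-step S mirrored =
      sort-pair S mirrored (proj₂ (slot-surjective S kᶠ)) (proj₂ (slot-surjective S (opposite kᶠ)))

  sort : (S : MatchedRealization ι) → ∀ k → k ≤ ν → Σ (MatchedRealization ι) (MirroredUpTo k)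
  sort S zero    _   = S , λ { _ (inj₁ ()) ; _ (inj₂ ()) }
  sort S (suc k) k<ν with S′ , mirrored ← sort S k (<⇒≤ k<ν) = sort-step k<ν S′ mirrored

  mirrored-edge : (S : MatchedRealization ι) → MirroredUpTo ν S →
    ∀ (i j : Fin n) → toℕ i < ν → toℕ i + toℕ j + 1 ≡ ν + ν → adj (MR.graph S) i j ≡ true
  mirrored-edge S mirrored i j i<ν i+j+1≡2ν =
    edge-subst graph (slot-edge p) (trans (cong ι slot-p) ι-i′)
                                   (trans (cong ι (trans (mirrored p (all-fixed _)) (cong opposite slot-p))) ι-j′)
    where
    open MatchedRealization S
    i′ : Fin (ν + ν)
    i′ = fromℕ< (<-≤-trans i<ν (m≤m+n ν ν))
    p = proj₁ (slot-surjective S i′)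
    slot-p : slot p ≡ i′
    slot-p = proj₂ (slot-surjective S i′)
    ι-i′ : ι i′ ≡ i
    ι-i′ = toℕ-injective (trans (toℕ-inject≤ i′ 2ν≤n) (toℕ-fromℕ< _))
    ι-j′ : ι (opposite i′) ≡ j
    ι-j′ = toℕ-injective (begin
      toℕ (ι (opposite i′))              ≡⟨ toℕ-inject≤ (opposite i′) 2ν≤n ⟩
      toℕ (opposite i′)                  ≡⟨ opposite-prop i′ ⟩
      ν + ν ∸ suc (toℕ i′)               ≡⟨ cong (λ x → ν + ν ∸ suc x) (toℕ-fromℕ< _) ⟩
      ν + ν ∸ suc (toℕ i)                ≡⟨ cong (_∸ suc (toℕ i)) (trans (sym i+j+1≡2ν)
                                                                          (+-comm (toℕ i + toℕ j) 1)) ⟩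
      suc (toℕ i) + toℕ j ∸ suc (toℕ i)  ≡⟨ m+n∸m≡n (suc (toℕ i)) (toℕ j) ⟩
      toℕ j                              ∎)

swap-halves : ∀ ν → Fin (ν + ν) → Fin (ν + ν)
swap-halves ν = join ν ν ∘ Sum.swap ∘ splitAt ν

swap-halves-involutive : ∀ ν → Involutive _≡_ (swap-halves ν)
swap-halves-involutive ν p = begin
  join ν ν (Sum.swap (splitAt ν (join ν ν (Sum.swap (splitAt ν p)))))
    ≡⟨ cong (join ν ν ∘ Sum.swap) (splitAt-join ν ν (Sum.swap (splitAt ν p))) ⟩
  join ν ν (Sum.swap (Sum.swap (splitAt ν p)))
    ≡⟨ cong (join ν ν) (swap-involutive (splitAt ν p)) ⟩
  join ν ν (splitAt ν p)
    ≡⟨ join-splitAt ν ν p ⟩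
  p ∎

module _ {G : Graph n} {ν : ℕ} (M : Matching G ν) where
  open Matching M

  matched-vertex : Fin (ν + ν) → Fin n
  matched-vertex = pairEnd end₁ end₂ ∘ splitAt ν

  matched-vertex-injective : Injective _≡_ _≡_ matched-vertex
  matched-vertex-injective {p} {q} eq =
    trans (sym (join-splitAt ν ν p))
          (trans (cong (join ν ν) (disjoint {splitAt ν p} {splitAt ν q} eq)) (join-splitAt ν ν q))

  matched-vertex-edge : ∀ p → adj G (matched-vertex p) (matched-vertex (swap-halves ν p)) ≡ true
  matched-vertex-edge p rewrite splitAt-join ν ν (Sum.swap (splitAt ν p)) with splitAt ν p
  ... | inj₁ k = isEdge k
  ... | inj₂ k = trans (adj-sym G (end₂ k) (end₁ k)) (isEdge k)

lemma15 : (n : ℕ) (d : Fin n → ℕ) → NonIncreasing d → Positive d →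
    (G : Graph n) → Realizes G d → (ν : ℕ) → Matching G ν →
    Σ (Graph n) (λ G′ → Realizes G′ d × 2 * ν ≤ n ×
      (∀ (i j : Fin n) → toℕ i < ν → toℕ i + toℕ j + 1 ≡ 2 * ν →
        adj G′ i j ≡ true))
lemma15 n d d-antitone _ G G-realizes ν M =
  let (S₁ , low)     = pack d-antitone S₀
      (S , mirrored) = sort (lower-slots S₁ low 2ν≤n) ν ≤-refl
  in  MR.graph S , MR.realizes S , subst (_≤ n) (sym 2*ν≡ν+ν) 2ν≤n ,
      λ i j i<ν i+j+1≡2ν → mirrored-edge S mirrored i j i<ν (trans i+j+1≡2ν 2*ν≡ν+ν)
  where
  2*ν≡ν+ν : 2 * ν ≡ ν + ν
  2*ν≡ν+ν = cong (ν +_) (+-identityʳ ν)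
  2ν≤n : ν + ν ≤ n
  2ν≤n = injective⇒≤ (matched-vertex-injective M)
  open Sorting d d-antitone {ν} 2ν≤n (swap-halves ν) (swap-halves-involutive ν)
  S₀ : MatchedRealization id
  S₀ = record
    { graph          = G
    ; realizes       = G-realizes
    ; slot           = matched-vertex M
    ; slot-injective = matched-vertex-injective M
    ; slot-edge      = matched-vertex-edge M
    }
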